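{- Let $G$ and $H$ be graphs, neither of which is a complete graph. Then for any two vertices $(g,h),(g',h')$ of $G\diamond H$, either $d_{G\diamond H}((g,h),(g',h'))\leq 3$, or $d_{G\diamond H}((g,h),(g',h'))=\infty$, the latter occurring only when $G$ and $H$ are both a disjoint union of two cliques.
   Context: All graphs are finite, simple and undirected. The modular product $G\diamond H$ has vertex set $V(G)\times V(H)$, and $(g,h)$, $(g',h')$ are adjacent if $g=g'$ and $hh'\in E(H)$, or $gg'\in E(G)$ and $h=h'$, or $gg'\in E(G)$ and $hh'\in E(H)$, or ($g\neq g'$, $h\neq h'$, $gg'\notin E(G)$ and $hh'\notin E(H)$). $d_X(u,v)$ is the length of a shortest $u,v$-path in $X$, and $d_X(u,v)=\infty$ if no such path exists. -}

module Defs where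

open import Data.Nat using (ℕ; zero; suc; _≤_)
open import Data.Fin using (Fin)
open import Data.Bool using (Bool; true; false)
open import Data.Product using (Σ; ∃; ∃-syntax; _×_; _,_)
open import Data.Sum using (_⊎_)
open import Relation.Nullary using (¬_; Dec)
open import Relation.Binary.PropositionalEquality using (_≡_; _≢_)
open import Function.Bundles using (_⇔_)

record Graph (n : ℕ) : Set₁ where
  field
    Adj    : Fin n → Fin n → Set
    irrefl : ∀ x → ¬ Adj x x
    sym    : ∀ {x y} → Adj x y → Adj y x
    dec    : ∀ x y → Dec (Adj x y)
open Graph public

IsComplete : ∀ {n} → Graph n → Set
IsComplete {n} G = ∀ (x y : Fin n) → x ≢ y → Adj G x y

IsTwoCliques : ∀ {n} → Graph n → Set
IsTwoCliques {n} G =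
  Σ (Fin n → Bool) λ f →
    (∀ (x y : Fin n) → x ≢ y → (Adj G x y ⇔ (f x ≡ f y)))
    × (∃[ x ] f x ≡ true) × (∃[ y ] f y ≡ false)

ModAdj : ∀ {n m} → Graph n → Graph m → (Fin n × Fin m) → (Fin n × Fin m) → Set
ModAdj G H (g , h) (g' , h') =
  (g ≡ g' × Adj H h h')
  ⊎ (Adj G g g' × h ≡ h')
  ⊎ (Adj G g g' × Adj H h h')
  ⊎ (g ≢ g' × h ≢ h' × ¬ Adj G g g' × ¬ Adj H h h')

data Walk {V : Set} (R : V → V → Set) : V → V → ℕ → Set where
  here : ∀ {u} → Walk R u u zero
  step : ∀ {u v w k} → R u v → Walk R v w k → Walk R u w (suc k)

-- d_R(u,v) ≤ k : some walk (hence a shortest path) of length ≤ k.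
DistLe : {V : Set} (R : V → V → Set) → V → V → ℕ → Set
DistLe R u v k = ∃[ j ] (j ≤ k × Walk R u v j)

DistInf : {V : Set} (R : V → V → Set) → V → V → Set
DistInf R u v = ∀ j → ¬ Walk R u v j

-- Write a ≈ b for "a = b or a ~ b". Two vertices (a, h) and (b, k) of G ⋄ H are adjacent
-- exactly when they are distinct and a ≈ b ⇔ h ≈ k, so whether two vertices are joined by
-- a short walk depends only on the kinds (equal, adjacent, apart) of the pairs among a few
-- vertices of G and of H.
--
-- Suppose d((g, h), (g', h')) > 3. Then x ≈ y ⇔ (g ≈ x ⇔ g ≈ y) for all x, y in G:
-- otherwise the points g, x, y, g' of G, and h, h' together with a non-edge c d of H such
-- that h = c or h ~ c, d, form four-point patterns, and an exhaustive search over all such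
-- patterns finds a walk of length at most 3. That condition says that G is the disjoint
-- union of the cliques {x | g ≈ x} and {x | g ≉ x}, the second one nonempty because G is
-- not complete; symmetrically for H. If σ and τ 2-colour these cliques of G and of H, then
-- σ a xor τ h is constant along the edges of G ⋄ H, whereas two vertices on which it agrees
-- are equal or adjacent; hence (g, h) and (g', h') lie in different components.

module Submission where

open import Defs
open import Data.Bool using (Bool; true; false; not; T; _xor_) renaming (_≟_ to _≟ᵇ_)
open import Data.Bool.Properties using (¬-not; not-¬; not-injective)
open import Data.Empty using (⊥-elim)
open import Data.Fin using (Fin; _≟_)
open import Data.Fin.Patterns using (0F; 1F; 2F; 3F)
open import Data.Fin.Properties using (any?; all?)
open import Data.Nat using (ℕ; zero; suc; _≤_; z≤n; s≤s)
open import Data.Nat.Properties using (anyUpTo?; ≤-trans)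
open import Data.Product using (∃; ∃-syntax; _×_; _,_; proj₁; proj₂; map; swap)
open import Data.Product.Properties using (≡-dec)
open import Data.Sum using (_⊎_; inj₁; inj₂)
open import Data.Unit using (tt)
open import Data.Vec using (_∷_; []; lookup)
open import Function.Base using (_∘_)
open import Function.Bundles using (_⇔_; mk⇔; Equivalence)
open import Function.Construct.Composition using (_⇔-∘_)
open import Function.Construct.Symmetry using (⇔-sym)
open import Relation.Binary.Definitions using (DecidableEquality)
open import Relation.Binary.PropositionalEquality
  using (_≡_; _≢_; refl; cong; subst) renaming (sym to ≡-sym; trans to ≡-trans)
open import Relation.Nullary using (¬_; Dec; yes; no; ¬?)
open import Relation.Nullary.Decidable
  using (map′; _×-dec_; _⊎-dec_; _→-dec_; T?; from-yes; decidable-stable)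

⇔⇒xor-≡ : ∀ {x y z w : Bool} → (x ≡ y ⇔ z ≡ w) → x xor z ≡ y xor w
⇔⇒xor-≡ {false} {false} e = Equivalence.to e refl
⇔⇒xor-≡ {true}  {true}  e = cong not (Equivalence.to e refl)
⇔⇒xor-≡ {false} {true}  e = ¬-not (not-¬ refl ∘ Equivalence.from e)
⇔⇒xor-≡ {true}  {false} e = ≡-sym (¬-not (not-¬ refl ∘ Equivalence.from e ∘ ≡-sym))

xor-≡⇒⇔ : ∀ {x y z w : Bool} → x xor z ≡ y xor w → (x ≡ y ⇔ z ≡ w)
xor-≡⇒⇔ {false} {false} e = mk⇔ (λ _ → e) (λ _ → refl)
xor-≡⇒⇔ {true}  {true}  e = mk⇔ (λ _ → not-injective e) (λ _ → refl)
xor-≡⇒⇔ {false} {true}  e = mk⇔ (λ ()) (λ z≡w → ⊥-elim (not-¬ z≡w e))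
xor-≡⇒⇔ {true}  {false} e = mk⇔ (λ ()) (λ z≡w → ⊥-elim (not-¬ (≡-sym z≡w) (≡-sym e)))

_⇔-dec_ : {A B : Set} → Dec A → Dec B → Dec (A ⇔ B)
A? ⇔-dec B? = map′ (λ (to , from) → mk⇔ to from) (λ e → Equivalence.to e , Equivalence.from e)
                   ((A? →-dec B?) ×-dec (B? →-dec A?))

Walk-map : ∀ {A B : Set} {R : A → A → Set} {S : B → B → Set} (f : A → B) →
           (∀ {u v} → R u v → S (f u) (f v)) →
           ∀ {u v k} → Walk R u v k → Walk S (f u) (f v) k
Walk-map f hom here       = here
Walk-map f hom (step r w) = step (hom r) (Walk-map f hom w)

DistLe-map : ∀ {A B : Set} {R : A → A → Set} {S : B → B → Set} (f : A → B) →
             (∀ {u v} → R u v → S (f u) (f v)) →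
             ∀ {u v k} → DistLe R u v k → DistLe S (f u) (f v) k
DistLe-map f hom (j , j≤k , w) = j , j≤k , Walk-map f hom w

DistLe-mono : ∀ {V : Set} {R : V → V → Set} {u v j k} → j ≤ k → DistLe R u v j → DistLe R u v k
DistLe-mono j≤k (i , i≤j , w) = i , ≤-trans i≤j j≤k , w

edge⇒distLe₁ : ∀ {V : Set} {R : V → V → Set} {u v} → R u v → DistLe R u v 1
edge⇒distLe₁ r = 1 , s≤s z≤n , step r here

module Search {V : Set} (_≟ᵥ_ : DecidableEquality V)
              (any-vertex? : ∀ {P : V → Set} → (∀ v → Dec (P v)) → Dec (∃ P))
              {R : V → V → Set} (R? : ∀ u v → Dec (R u v)) where

  walk? : ∀ k u v → Dec (Walk R u v k)
  walk? zero    u v = map′ (λ { refl → here }) (λ { here → refl }) (u ≟ᵥ v)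
  walk? (suc k) u v = map′ (λ (w , r , p) → step r p) (λ { (step r p) → _ , r , p })
                           (any-vertex? λ w → R? u w ×-dec walk? k w v)

  distLe? : ∀ k u v → Dec (DistLe R u v k)
  distLe? k u v = map′ (λ { (j , s≤s j≤k , p) → j , j≤k , p }) (λ (j , j≤k , p) → j , s≤s j≤k , p)
                       (anyUpTo? (λ j → walk? j u v) (suc k))

any-pair? : ∀ {a b} {P : Fin a × Fin b → Set} → (∀ v → Dec (P v)) → Dec (∃ P)
any-pair? P? = map′ (λ (i , j , p) → (i , j) , p) (λ ((i , j) , p) → i , j , p)
                    (any? λ i → any? λ j → P? (i , j))

distLe? : ∀ {a b} {R : Fin a × Fin b → Fin a × Fin b → Set} → (∀ u v → Dec (R u v)) →
          ∀ k u v → Dec (DistLe R u v k)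
distLe? R? = Search.distLe? (≡-dec _≟_ _≟_) any-pair? R?

modAdj? : ∀ {n m} (G : Graph n) (H : Graph m) → ∀ u v → Dec (ModAdj G H u v)
modAdj? G H (a , h) (b , k) =
  ((a ≟ b) ×-dec dec H h k) ⊎-dec ((dec G a b ×-dec (h ≟ k)) ⊎-dec
    ((dec G a b ×-dec dec H h k) ⊎-dec
     (¬? (a ≟ b) ×-dec ¬? (h ≟ k) ×-dec ¬? (dec G a b) ×-dec ¬? (dec H h k))))

ModAdj-swap : ∀ {n m} {G : Graph n} {H : Graph m} {u v} →
              ModAdj H G u v → ModAdj G H (swap u) (swap v)
ModAdj-swap (inj₁ (p , q))                       = inj₂ (inj₁ (q , p))
ModAdj-swap (inj₂ (inj₁ (p , q)))                = inj₁ (q , p)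
ModAdj-swap (inj₂ (inj₂ (inj₁ (p , q))))         = inj₂ (inj₂ (inj₁ (q , p)))
ModAdj-swap (inj₂ (inj₂ (inj₂ (p , q , r , s)))) = inj₂ (inj₂ (inj₂ (q , p , s , r)))

data Kind : Set where
  equal adjacent apart : Kind

_≟ₖ_ : DecidableEquality Kind
equal    ≟ₖ equal    = yes refl
adjacent ≟ₖ adjacent = yes refl
apart    ≟ₖ apart    = yes refl
equal    ≟ₖ adjacent = no λ ()
equal    ≟ₖ apart    = no λ ()
adjacent ≟ₖ equal    = no λ ()
adjacent ≟ₖ apart    = no λ ()
apart    ≟ₖ equal    = no λ ()
apart    ≟ₖ adjacent = no λ ()

all-kinds? : {P : Kind → Set} → (∀ k → Dec (P k)) → Dec (∀ k → P k)
all-kinds? P? = map′ (λ (e , a , d) → λ { equal → e ; adjacent → a ; apart → d })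
                     (λ all → all equal , all adjacent , all apart)
                     (P? equal ×-dec P? adjacent ×-dec P? apart)

near : Kind → Bool
near apart = false
near _     = true

linked : Kind → Kind → Bool
linked equal    adjacent = true
linked adjacent equal    = true
linked adjacent adjacent = true
linked apart    apart    = true
linked _        _        = false

data KindOf {n} (G : Graph n) (a b : Fin n) : Kind → Set where
  equal    : a ≡ b → KindOf G a b equal
  adjacent : Adj G a b → KindOf G a b adjacent
  apart    : a ≢ b → ¬ Adj G a b → KindOf G a b apart

module _ {n} (G : Graph n) where

  kindOf : ∀ a b → ∃ (KindOf G a b)
  kindOf a b with a ≟ b | dec G a b
  ... | yes a≡b | _      = equal , equal a≡b
  ... | no a≢b  | yes ab = adjacent , adjacent ab
  ... | no a≢b  | no ¬ab = apart , apart a≢b ¬ab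

  nonEdge : ¬ IsComplete G → ∃[ a ] ∃[ b ] KindOf G a b apart
  nonEdge incomplete with any? (λ a → any? λ b → ¬? (a ≟ b) ×-dec ¬? (dec G a b))
  ... | yes (a , b , a≢b , ¬ab) = a , b , apart a≢b ¬ab
  ... | no none = ⊥-elim (incomplete λ a b a≢b →
                    decidable-stable (dec G a b) λ ¬ab → none (a , b , a≢b , ¬ab))

  adj⇒≢ : ∀ {a b} → Adj G a b → a ≢ b
  adj⇒≢ ab refl = irrefl G _ ab

module _ {n} {G : Graph n} where

  KindOf-equal⇒≡ : ∀ {a b} → KindOf G a b equal → a ≡ b
  KindOf-equal⇒≡ (equal a≡b) = a≡b

  KindOf-sym : ∀ {a b k} → KindOf G a b k → KindOf G b a k
  KindOf-sym (equal a≡b)     = equal (≡-sym a≡b)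
  KindOf-sym (adjacent ab)   = adjacent (sym G ab)
  KindOf-sym (apart a≢b ¬ab) = apart (a≢b ∘ ≡-sym) (¬ab ∘ sym G)

  KindOf-unique : ∀ {a b k l} → KindOf G a b k → KindOf G a b l → k ≡ l
  KindOf-unique (equal _)     (equal _)     = refl
  KindOf-unique (adjacent _)  (adjacent _)  = refl
  KindOf-unique (apart _ _)   (apart _ _)   = refl
  KindOf-unique (equal refl)  (adjacent aa) = ⊥-elim (irrefl G _ aa)
  KindOf-unique (equal a≡b)   (apart a≢b _) = ⊥-elim (a≢b a≡b)
  KindOf-unique (adjacent aa) (equal refl)  = ⊥-elim (irrefl G _ aa)
  KindOf-unique (adjacent ab) (apart _ ¬ab) = ⊥-elim (¬ab ab)
  KindOf-unique (apart a≢b _) (equal a≡b)   = ⊥-elim (a≢b a≡b)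
  KindOf-unique (apart _ ¬ab) (adjacent ab) = ⊥-elim (¬ab ab)

  adj⇔near : ∀ {a b k} → a ≢ b → KindOf G a b k → Adj G a b ⇔ T (near k)
  adj⇔near a≢b (equal a≡b)   = ⊥-elim (a≢b a≡b)
  adj⇔near _   (adjacent ab) = mk⇔ (λ _ → tt) (λ _ → ab)
  adj⇔near _   (apart _ ¬ab) = mk⇔ ¬ab λ ()

module _ {n m} {G : Graph n} {H : Graph m} where

  linked⇒ModAdj : ∀ {a b h k s t} → KindOf G a b s → KindOf H h k t → T (linked s t) →
                  ModAdj G H (a , h) (b , k)
  linked⇒ModAdj (equal a≡b)     (adjacent hk)   _ = inj₁ (a≡b , hk)
  linked⇒ModAdj (adjacent ab)   (equal h≡k)     _ = inj₂ (inj₁ (ab , h≡k))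
  linked⇒ModAdj (adjacent ab)   (adjacent hk)   _ = inj₂ (inj₂ (inj₁ (ab , hk)))
  linked⇒ModAdj (apart a≢b ¬ab) (apart h≢k ¬hk) _ = inj₂ (inj₂ (inj₂ (a≢b , h≢k , ¬ab , ¬hk)))
  linked⇒ModAdj (equal _)       (equal _)       ()
  linked⇒ModAdj (equal _)       (apart _ _)     ()
  linked⇒ModAdj (adjacent _)    (apart _ _)     ()
  linked⇒ModAdj (apart _ _)     (equal _)       ()
  linked⇒ModAdj (apart _ _)     (adjacent _)    ()

  near⇔⇒distLe₁ : ∀ {a b h k s t} → KindOf G a b s → KindOf H h k t → T (near s) ⇔ T (near t) →
                  DistLe (ModAdj G H) (a , h) (b , k) 1
  near⇔⇒distLe₁ (equal refl)    (equal refl)    _ = 0 , z≤n , here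
  near⇔⇒distLe₁ ab@(equal _)    hk@(adjacent _) _ = edge⇒distLe₁ (linked⇒ModAdj ab hk tt)
  near⇔⇒distLe₁ ab@(adjacent _) hk@(equal _)    _ = edge⇒distLe₁ (linked⇒ModAdj ab hk tt)
  near⇔⇒distLe₁ ab@(adjacent _) hk@(adjacent _) _ = edge⇒distLe₁ (linked⇒ModAdj ab hk tt)
  near⇔⇒distLe₁ ab@(apart _ _)  hk@(apart _ _)  _ = edge⇒distLe₁ (linked⇒ModAdj ab hk tt)
  near⇔⇒distLe₁ (equal _)       (apart _ _)     e = ⊥-elim (Equivalence.to e tt)
  near⇔⇒distLe₁ (adjacent _)    (apart _ _)     e = ⊥-elim (Equivalence.to e tt)
  near⇔⇒distLe₁ (apart _ _)     (equal _)       e = ⊥-elim (Equivalence.from e tt)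
  near⇔⇒distLe₁ (apart _ _)     (adjacent _)    e = ⊥-elim (Equivalence.from e tt)

Pattern : ℕ → Set
Pattern k = Fin k → Fin k → Kind

Realises : ∀ {n k} → Graph n → (Fin k → Fin n) → Pattern k → Set
Realises G v P = ∀ i j → KindOf G (v i) (v j) (P i j)

-- Exhaustive search also meets patterns realised by no graph, on which it may fail;
-- this necessary condition for realisability excludes enough of them.
WellFormed : ∀ {k} → Pattern k → Set
WellFormed P = ∀ i j l → P i j ≡ equal → P i l ≡ P j l

wellFormed? : ∀ {k} (P : Pattern k) → Dec (WellFormed P)
wellFormed? P = all? λ i → all? λ j → all? λ l → (P i j ≟ₖ equal) →-dec (P i l ≟ₖ P j l)

Realises⇒WellFormed : ∀ {n k} {G : Graph n} {v : Fin k → Fin n} {P} → Realises G v P → WellFormed P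
Realises⇒WellFormed {G = G} {v} {P} real i j l Pij≡equal =
  KindOf-unique (real i l) (subst (λ x → KindOf G x (v l) (P j l)) vj≡vi (real j l))
  where
  vj≡vi : v j ≡ v i
  vj≡vi = ≡-sym (KindOf-equal⇒≡ (subst (KindOf G (v i) (v j)) Pij≡equal (real i j)))

_⋄ᴾ_ : ∀ {a b} → Pattern a → Pattern b → Fin a × Fin b → Fin a × Fin b → Set
(P ⋄ᴾ Q) (i , p) (j , q) = T (linked (P i j) (Q p q))

_⋄ᴾ?_ : ∀ {a b} (P : Pattern a) (Q : Pattern b) → ∀ u v → Dec ((P ⋄ᴾ Q) u v)
(P ⋄ᴾ? Q) (i , p) (j , q) = T? (linked (P i j) (Q p q))

realise-distLe : ∀ {n m a b k} {G : Graph n} {H : Graph m}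
                   {v : Fin a → Fin n} {w : Fin b → Fin m} {P Q} →
                 Realises G v P → Realises H w Q → ∀ {x y} →
                 DistLe (P ⋄ᴾ Q) x y k → DistLe (ModAdj G H) (map v w x) (map v w y) k
realise-distLe realG realH = DistLe-map (map _ _) λ {x} {y} →
  linked⇒ModAdj (realG (proj₁ x) (proj₁ y)) (realH (proj₂ x) (proj₂ y))

pattern₄ : (k₀₁ k₀₂ k₁₂ k₀₃ k₁₃ k₂₃ : Kind) → Pattern 4
pattern₄ k₀₁ k₀₂ k₁₂ k₀₃ k₁₃ k₂₃ = λ
  { 0F 0F → equal ; 0F 1F → k₀₁   ; 0F 2F → k₀₂   ; 0F 3F → k₀₃
  ; 1F 0F → k₀₁   ; 1F 1F → equal ; 1F 2F → k₁₂   ; 1F 3F → k₁₃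
  ; 2F 0F → k₀₂   ; 2F 1F → k₁₂   ; 2F 2F → equal ; 2F 3F → k₂₃
  ; 3F 0F → k₀₃   ; 3F 1F → k₁₃   ; 3F 2F → k₂₃   ; 3F 3F → equal
  }

realises₄ : ∀ {n} {G : Graph n} {x₀ x₁ x₂ x₃ k₀₁ k₀₂ k₁₂ k₀₃ k₁₃ k₂₃} →
            KindOf G x₀ x₁ k₀₁ → KindOf G x₀ x₂ k₀₂ → KindOf G x₁ x₂ k₁₂ →
            KindOf G x₀ x₃ k₀₃ → KindOf G x₁ x₃ k₁₃ → KindOf G x₂ x₃ k₂₃ →
            Realises G (lookup (x₀ ∷ x₁ ∷ x₂ ∷ x₃ ∷ [])) (pattern₄ k₀₁ k₀₂ k₁₂ k₀₃ k₁₃ k₂₃)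
realises₄ r₀₁ r₀₂ r₁₂ r₀₃ r₁₃ r₂₃ = λ
  { 0F 0F → equal refl     ; 0F 1F → r₀₁            ; 0F 2F → r₀₂            ; 0F 3F → r₀₃
  ; 1F 0F → KindOf-sym r₀₁ ; 1F 1F → equal refl     ; 1F 2F → r₁₂            ; 1F 3F → r₁₃
  ; 2F 0F → KindOf-sym r₀₂ ; 2F 1F → KindOf-sym r₁₂ ; 2F 2F → equal refl     ; 2F 3F → r₂₃
  ; 3F 0F → KindOf-sym r₀₃ ; 3F 1F → KindOf-sym r₁₃ ; 3F 2F → KindOf-sym r₂₃ ; 3F 3F → equal refl
  }

Coherent : Kind → Kind → Kind → Set
Coherent a b c = T (near c) ⇔ (near a ≡ near b)

coherent? : ∀ a b c → Dec (Coherent a b c)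
coherent? a b c = T? (near c) ⇔-dec (near a ≟ᵇ near b)

data Sees : Kind → Kind → Set where
  endpoint : Sees equal apart
  apex     : Sees adjacent adjacent

all-sightings? : {P : Kind → Kind → Set} → (∀ p q → Dec (P p q)) → Dec (∀ {p q} → Sees p q → P p q)
all-sightings? P? = map′ (λ (e , a) → λ { endpoint → e ; apex → a })
                         (λ all → all endpoint , all apex)
                         (P? equal apart ×-dec P? adjacent adjacent)

sees-nonEdge : ∀ {n} (G : Graph n) → ¬ IsComplete G → ∀ h →
               ∃[ c ] ∃[ d ] ∃[ p ] ∃[ q ]
                 Sees p q × KindOf G h c p × KindOf G h d q × KindOf G c d apart
sees-nonEdge G incomplete h with nonEdge G incomplete
... | a , b , ab with kindOf G h a | kindOf G h b
...   | apart , ha         | _                  = h , a , _ , _ , endpoint , equal refl , ha , ha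
...   | equal , equal refl | _                  = h , b , _ , _ , endpoint , equal refl , ab , ab
...   | adjacent , _       | apart , hb         = h , b , _ , _ , endpoint , equal refl , hb , hb
...   | adjacent , _       | equal , equal refl =
          h , a , _ , _ , endpoint , equal refl , KindOf-sym ab , KindOf-sym ab
...   | adjacent , ha      | adjacent , hb      = a , b , _ , _ , apex , ha , hb , ab

-- Point 0 is the start vertex and point 3 the end vertex; in G, points 1 and 2 form an
-- incoherent triangle with 0, in H they are a non-edge seen from 0.
incoherent-pattern-distLe₃ :
  ∀ a b c → ¬ Coherent a b c → ∀ s e f → WellFormed (pattern₄ a b c s e f) →
  ∀ {p q} → Sees p q → ∀ t r w → WellFormed (pattern₄ p q apart t r w) →
  DistLe (pattern₄ a b c s e f ⋄ᴾ pattern₄ p q apart t r w) (0F , 0F) (3F , 3F) 3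
incoherent-pattern-distLe₃ = from-yes
  (all-kinds? λ a → all-kinds? λ b → all-kinds? λ c → ¬? (coherent? a b c) →-dec
   (all-kinds? λ s → all-kinds? λ e → all-kinds? λ f → wellFormed? (pattern₄ a b c s e f) →-dec
    all-sightings? λ p q → all-kinds? λ t → all-kinds? λ r → all-kinds? λ w →
      wellFormed? (pattern₄ p q apart t r w) →-dec
      distLe? (pattern₄ a b c s e f ⋄ᴾ? pattern₄ p q apart t r w) 3 (0F , 0F) (3F , 3F)))

far⇒coherent : ∀ {n m} (G : Graph n) (H : Graph m) → ¬ IsComplete H →
               ∀ {g g' h h'} → ¬ DistLe (ModAdj G H) (g , h) (g' , h') 3 →
               ∀ {x y a b c} → KindOf G g x a → KindOf G g y b → KindOf G x y c → Coherent a b c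
far⇒coherent G H incompleteH {g} {g'} {h} {h'} far {x} {y} {a} {b} {c} gx gy xy
  with sees-nonEdge H incompleteH h
... | c' , d' , _ , _ , sees , hc' , hd' , c'd'
  with kindOf G g g' | kindOf G x g' | kindOf G y g'
     | kindOf H h h' | kindOf H c' h' | kindOf H d' h'
... | s , gg' | e , xg' | f , yg' | t , hh' | r , c'h' | w , d'h' =
  decidable-stable (coherent? a b c) λ incoherent →
    far (realise-distLe realG realH
          (incoherent-pattern-distLe₃ a b c incoherent s e f (Realises⇒WellFormed realG)
                                      sees t r w (Realises⇒WellFormed realH)))
  where
  realG = realises₄ gx gy xy gg' xg' yg'
  realH = realises₄ hc' hd' c'd' hh' c'h' d'h'

Splits : ∀ {n} → Graph n → (Fin n → Bool) → Set
Splits {n} G σ = ∀ (x y : Fin n) → x ≢ y → Adj G x y ⇔ (σ x ≡ σ y)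

coherent⇒twoCliques : ∀ {n} (G : Graph n) (g : Fin n) → ¬ IsComplete G →
                      (∀ {x y a b c} → KindOf G g x a → KindOf G g y b → KindOf G x y c →
                                       Coherent a b c) →
                      IsTwoCliques G
coherent⇒twoCliques {n} G g incomplete coherent = side , splits , (g , side-g) , other-side
  where
  side : Fin n → Bool
  side x = near (proj₁ (kindOf G g x))

  splits : Splits G side
  splits x y x≢y = coherent (proj₂ (kindOf G g x)) (proj₂ (kindOf G g y)) xy ⇔-∘ adj⇔near x≢y xy
    where xy = proj₂ (kindOf G x y)

  side-g : side g ≡ true
  side-g = cong near (KindOf-unique (proj₂ (kindOf G g g)) (equal refl))

  other-side : ∃[ y ] side y ≡ false
  other-side with nonEdge G incomplete
  ... | a , b , apart a≢b ¬ab with side a in side-a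
  ...   | false = a , side-a
  ...   | true  = b , ≡-trans (¬-not (¬ab ∘ Equivalence.from (splits a b a≢b) ∘ ≡-sym))
                              (cong not side-a)

splits⇒near : ∀ {n} {G : Graph n} {σ : Fin n → Bool} → Splits G σ →
              ∀ {a b k} → KindOf G a b k → T (near k) ⇔ (σ a ≡ σ b)
splits⇒near σ-splits (equal refl) = mk⇔ (λ _ → refl) (λ _ → tt)
splits⇒near {G = G} σ-splits ab@(adjacent a~b) =
  σ-splits _ _ (adj⇒≢ G a~b) ⇔-∘ ⇔-sym (adj⇔near (adj⇒≢ G a~b) ab)
splits⇒near σ-splits ab@(apart a≢b _) = σ-splits _ _ a≢b ⇔-∘ ⇔-sym (adj⇔near a≢b ab)

module Classes {n m} {G : Graph n} {H : Graph m} {σ : Fin n → Bool} {τ : Fin m → Bool}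
               (σ-splits : Splits G σ) (τ-splits : Splits H τ) where

  class : Fin n × Fin m → Bool
  class (a , h) = σ a xor τ h

  private
    nearG : ∀ {a b s} → KindOf G a b s → T (near s) ⇔ (σ a ≡ σ b)
    nearG = splits⇒near σ-splits

    nearH : ∀ {h k t} → KindOf H h k t → T (near t) ⇔ (τ h ≡ τ k)
    nearH = splits⇒near τ-splits

  ModAdj⇒sides-agree : ∀ {a b h k} → ModAdj G H (a , h) (b , k) → (σ a ≡ σ b) ⇔ (τ h ≡ τ k)
  ModAdj⇒sides-agree (inj₁ (refl , hk)) =
    nearH (adjacent hk) ⇔-∘ ⇔-sym (nearG (equal refl))
  ModAdj⇒sides-agree (inj₂ (inj₁ (ab , refl))) =
    nearH (equal refl) ⇔-∘ ⇔-sym (nearG (adjacent ab))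
  ModAdj⇒sides-agree (inj₂ (inj₂ (inj₁ (ab , hk)))) =
    nearH (adjacent hk) ⇔-∘ ⇔-sym (nearG (adjacent ab))
  ModAdj⇒sides-agree (inj₂ (inj₂ (inj₂ (a≢b , h≢k , ¬ab , ¬hk)))) =
    nearH (apart h≢k ¬hk) ⇔-∘ ⇔-sym (nearG (apart a≢b ¬ab))

  class-walk : ∀ {u v j} → Walk (ModAdj G H) u v j → class u ≡ class v
  class-walk here       = refl
  class-walk (step e w) = ≡-trans (⇔⇒xor-≡ (ModAdj⇒sides-agree e)) (class-walk w)

  class-distLe₁ : ∀ {a b h k} → class (a , h) ≡ class (b , k) →
                  DistLe (ModAdj G H) (a , h) (b , k) 1
  class-distLe₁ {a} {b} {h} {k} e =
    near⇔⇒distLe₁ ab hk (⇔-sym (nearH hk) ⇔-∘ (xor-≡⇒⇔ e ⇔-∘ nearG ab))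
    where
    ab = proj₂ (kindOf G a b)
    hk = proj₂ (kindOf H h k)

theorem3p1 : ∀ {n m} (G : Graph n) (H : Graph m) → ¬ IsComplete G → ¬ IsComplete H →
    ∀ (g g' : Fin n) (h h' : Fin m) →
      (DistLe (ModAdj G H) (g , h) (g' , h') 3 ⊎ DistInf (ModAdj G H) (g , h) (g' , h'))
      × (DistInf (ModAdj G H) (g , h) (g' , h') → IsTwoCliques G × IsTwoCliques H)
theorem3p1 G H incompleteG incompleteH g g' h h' with distLe? (modAdj? G H) 3 (g , h) (g' , h')
... | yes close = inj₁ close , λ unreachable → ⊥-elim (unreachable _ (proj₂ (proj₂ close)))
... | no far    = inj₂ unreachable , λ _ → twoG , twoH
  where
  twoG : IsTwoCliques G
  twoG = coherent⇒twoCliques G g incompleteG (far⇒coherent G H incompleteH far)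

  twoH : IsTwoCliques H
  twoH = coherent⇒twoCliques H h incompleteH
           (far⇒coherent H G incompleteG (far ∘ DistLe-map swap (ModAdj-swap {G = G} {H})))

  unreachable : DistInf (ModAdj G H) (g , h) (g' , h')
  unreachable _ walk = far (DistLe-mono (s≤s z≤n) (class-distLe₁ (class-walk walk)))
    where open Classes {G = G} {H} (proj₁ (proj₂ twoG)) (proj₁ (proj₂ twoH))
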